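{- For all $t\in\{1,\ldots,T\}$, $k'\in\{0,\ldots,k\}$ with $\Pr[I^{\mathsf{Exp}}_{t-1}=k']>0$, and $j\in\{1,\ldots,m+1\}$, $\Pr[P^{\mathsf{Exp}}_t=r^{(j)}\mid I^{\mathsf{Exp}}_{t-1}=k']=\Pr[P^{\mathsf{A1}}_t=r^{(j)}\mid I^{\mathsf{A1}}_{t-1}=k']$. Moreover, for all $t\in\{0,\ldots,T\}$ and $k'\in\{0,\ldots,k\}$, $\Pr[I^{\mathsf{Exp}}_t=k']=\Pr[I^{\mathsf{A1}}_t=k']$. (Here probabilities for $\mathsf{A1}$ are over valuations $V_t$ drawn independently from $\mathbf{v}_t$ and the algorithm's randomness.)
   Context: Setting (single-item dynamic pricing, public pricing, stochastic valuations). Fix $m\ge1$, prices $0<r^{(1)}<\cdots<r^{(m)}$, $r^{(0)}=0$, $r^{(m+1)}=\infty$, inventory $k\ge1$. Customer $t=1,\ldots,T$ has valuation $V_t\in\{r^{(0)},\ldots,r^{(m)}\}$ drawn from a distribution $\mathbf{v}_t=(v^{(0)}_t,\ldots,v^{(m)}_t)$, independently across customers (not necessarily identically). A public pricing algorithm chooses a (possibly random) price $P_t\in\{r^{(1)},\ldots,r^{(m+1)}\}$ before seeing anything about customer $t$; after the choice it learns $\mathbf{v}_t$ and whether a sale occurred. $X_t=\mathbb{1}(V_t\ge P_t)$; $I_t=k-\sum_{t'\le t}X_{t'}$ ($I_0=k$). Superscripts denote which algorithm's run a random variable belongs to. Let $q^{(j)}=1-r^{(j-1)}/r^{(j)}$.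 Algorithm VT ($\mathsf{A1}$): initialize $\mathtt{level}[i]=0$, $\mathtt{sold}[i]=\mathtt{false}$ for $i=1,\ldots,k$. For each customer $t$: let $i^*_t$ minimize $\mathtt{level}[i]$ (fixed deterministic tie-breaking), and $\ell_t$ satisfy $\mathtt{level}[i^*_t]=r^{(\ell_t)}$. If $\mathtt{sold}[i^*_t]=\mathtt{false}$, choose price $r^{(j)}$, $j\in\{\ell_t+1,\ldots,m\}$, w.p. $q^{(j)}/\sum_{j'=\ell_t+1}^mq^{(j')}$; else price $\infty$. Then observe $V_t,X_t$, set $\mathtt{level}[i^*_t]=\max\{\mathtt{level}[i^*_t],V_t\}$, and if $X_t=1$ set $\mathtt{sold}[i^*_t]=\mathtt{true}$. Algorithm $\mathsf{Exp}$: at time $t$, having observed $\mathbf{v}_1,\ldots,\mathbf{v}_{t-1}$ and having $k'$ units remaining, consider a run of Algorithm VT in which $V_1,\ldots,V_{t-1}$ are drawn independently from $\mathbf{v}_1,\ldots,\mathbf{v}_{t-1}$; if $\Pr[I^{\mathsf{A1}}_{t-1}=k']>0$, choose price $r^{(j)}$ with probability $\Pr[P^{\mathsf{A1}}_t=r^{(j)}\mid I^{\mathsf{A1}}_{t-1}=k']$ for each $j\in\{1,\ldots,m+1\}$ (probability over valuations and the algorithm's randomness); otherwise choose price $\infty$.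
   Formalization: The prices $r^{(j)}$ are rational, and each valuation distribution $\mathbf{v}_t$ assigns rational probabilities to the valuations. -}

module Defs where

open import Data.Nat as ℕ using (ℕ; zero; suc)
open import Data.Bool using (Bool; true; false; if_then_else_; not; _∧_; T?)
open import Data.Fin as Fin using (Fin; toℕ; inject₁)
open import Data.Fin.Properties using () renaming (_≟_ to _≟ᶠ_)
open import Data.List using (List; []; _∷_; map; concatMap; filter; foldr; allFin)
open import Data.Maybe using (Maybe; just; nothing)
open import Data.Product using (_×_; _,_; proj₁; proj₂)
open import Data.Vec using (Vec; replicate; lookup; _[_]≔_)
open import Data.Rational as ℚ using (ℚ; 0ℚ; 1ℚ; _+_; _*_; _-_; _÷_; _≤_; _<_)
open import Relation.Nullary using (yes; no; ¬_)
open import Relation.Nullary.Decidable using (⌊_⌋)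
open import Relation.Binary.PropositionalEquality using (_≡_)

-- Finitely supported (sub)probability distributions with rational weights

Dist : Set → Set
Dist A = List (A × ℚ)

return : {A : Set} → A → Dist A
return a = (a , 1ℚ) ∷ []

_>>=_ : {A B : Set} → Dist A → (A → Dist B) → Dist B
d >>= f = concatMap (λ aw → map (λ bw → (proj₁ bw , proj₂ aw * proj₂ bw)) (f (proj₁ aw))) d

sumℚ : List ℚ → ℚ
sumℚ = foldr _+_ 0ℚ

Pr : {A : Set} → Dist A → (A → Bool) → ℚ
Pr d E = sumℚ (map proj₂ (filter (λ aw → T? (E (proj₁ aw))) d))

-- safe division: a / b if b ≠ 0, and 0 otherwise (only used where b ≠ 0 matters)
cdiv : ℚ → ℚ → ℚ
cdiv a b with b ℚ.≟ 0ℚ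
... | yes _  = 0ℚ
... | no b≢0 = _÷_ a b {{ℚ.≢-nonZero b≢0}}

CondPr : {A : Set} → Dist A → (A → Bool) → (A → Bool) → ℚ
CondPr d E F = cdiv (Pr d (λ a → E a ∧ F a)) (Pr d F)

-- Market model.
--   r : Fin m → ℚ      r i  is the price  r^(i+1)            (i = 0..m-1)
--   valuation levels   Fin (suc m),  level ℓ has value r^(ℓ)  (r^(0) = 0)
--   posted prices      Price m = Maybe (Fin m):  just i = r^(i+1),  nothing = r^(m+1) = ∞
--   v : ℕ → Fin (suc m) → ℚ     v t ℓ = v_t^(ℓ) = Pr[V_t = r^(ℓ)]

Price : ℕ → Set
Price m = Maybe (Fin m)

_≟P_ : {m : ℕ} → Price m → Price m → Bool
nothing ≟P nothing = true
nothing ≟P just _  = false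
just _  ≟P nothing = false
just i  ≟P just j  = ⌊ i ≟ᶠ j ⌋

val : {m : ℕ} → (Fin m → ℚ) → Fin (suc m) → ℚ
val r Fin.zero    = 0ℚ
val r (Fin.suc i) = r i

sale : {m : ℕ} → (Fin m → ℚ) → Price m → Fin (suc m) → Bool
sale r nothing  ℓ = false
sale r (just j) ℓ = ⌊ r j ℚ.≤? val r ℓ ⌋

-- q^(j) = 1 - r^(j-1)/r^(j), for price index j = i+1
q : {m : ℕ} → (Fin m → ℚ) → Fin m → ℚ
q r i = 1ℚ - cdiv (val r (inject₁ i)) (r i)

valDist : {m : ℕ} → (ℕ → Fin (suc m) → ℚ) → ℕ → Dist (Fin (suc m))
valDist v t = map (λ ℓ → (ℓ , v t ℓ)) (allFin _)

record StateA1 (m k : ℕ) : Set where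
  constructor st
  field
    level : Vec (Fin (suc m)) k
    sold  : Vec Bool k
    cnt   : ℕ                     -- number of sales so far; inventory = k - cnt

open StateA1 public

initA1 : {m k : ℕ} → StateA1 m k
initA1 = st (replicate _ Fin.zero) (replicate _ false) 0

-- prices r^(j), j ∈ {ℓ+1, …, m}  (as indices i with i+1 = j, i.e. toℕ i ≥ ℓ)
above : {m : ℕ} → Fin (suc m) → List (Fin m)
above {m} ℓ = filter (λ i → toℕ ℓ ℕ.≤? toℕ i) (allFin m)

-- price distribution when the minimal-level unit has level ℓ and is unsold.
-- (The case of an empty index set is unreachable; we post ∞ there.)
vtPrice : {m : ℕ} → (Fin m → ℚ) → Fin (suc m) → Dist (Price m)
vtPrice r ℓ with above ℓ
... | []       = return nothing
... | is@(_ ∷ _) = map (λ i → (just i , cdiv (q r i) (sumℚ (map (q r) is)))) is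

-- tie-breaking rule tb : levels ↦ chosen unit (assumed a minimizer)
priceA1 : {m k : ℕ} → (Fin m → ℚ) → (Vec (Fin (suc m)) k → Fin k) →
          StateA1 m k → Dist (Price m)
priceA1 r tb s = if lookup (sold s) i then return nothing else vtPrice r (lookup (level s) i)
  where i = tb (level s)

maxF : {m : ℕ} → Fin (suc m) → Fin (suc m) → Fin (suc m)
maxF a b = if ⌊ toℕ a ℕ.≤? toℕ b ⌋ then b else a

b2n : Bool → ℕ
b2n true  = 1
b2n false = 0

updateA1 : {m k : ℕ} → (Fin m → ℚ) → (Vec (Fin (suc m)) k → Fin k) →
           StateA1 m k → Price m → Fin (suc m) → StateA1 m k
updateA1 r tb s p ℓ =
  st (level s [ i ]≔ maxF (lookup (level s) i) ℓ)
     (if x then sold s [ i ]≔ true else sold s)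
     (cnt s ℕ.+ b2n x)
  where
  i = tb (level s)
  x = sale r p ℓ

runA1 : {m k : ℕ} → (Fin m → ℚ) → (Vec (Fin (suc m)) k → Fin k) →
        (ℕ → Fin (suc m) → ℚ) → ℕ → Dist (StateA1 m k)
runA1 r tb v zero    = return initA1
runA1 r tb v (suc t) =
  runA1 r tb v t >>= λ s →
  priceA1 r tb s >>= λ p →
  valDist v (suc t) >>= λ ℓ →
  return (updateA1 r tb s p ℓ)

-- joint distribution of (state after customers 1..t-1 , P_t), for t ≥ 1
jointA1 : {m k : ℕ} → (Fin m → ℚ) → (Vec (Fin (suc m)) k → Fin k) →
          (ℕ → Fin (suc m) → ℚ) → ℕ → Dist (StateA1 m k × Price m)
jointA1 r tb v t = runA1 r tb v (t ℕ.∸ 1) >>= λ s → priceA1 r tb s >>= λ p → return (s , p)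

-- event  I = k'   (I = k - cnt)
invIs : ℕ → ℕ → ℕ → Bool
invIs k c k' = ⌊ c ℕ.+ k' ℕ.≟ k ⌋

-- Algorithm Exp.  Its state is the number of sales so far (k' = k - c remain).

priceExp : {m k : ℕ} → (Fin m → ℚ) → (Vec (Fin (suc m)) k → Fin k) →
           (ℕ → Fin (suc m) → ℚ) → ℕ → ℕ → Dist (Price m)
priceExp {m} {k} r tb v t c with Pr (jointA1 r tb v t) (λ sp → invIs k (cnt (proj₁ sp)) k') ℚ.≟ 0ℚ
  where k' = k ℕ.∸ c
... | yes _ = return nothing
... | no  _ = map (λ p → (p , CondPr (jointA1 r tb v t)
                                 (λ sp → proj₂ sp ≟P p)
                                 (λ sp → invIs k (cnt (proj₁ sp)) (k ℕ.∸ c))))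
                  (nothing ∷ map just (allFin m))

runExp : {m k : ℕ} → (Fin m → ℚ) → (Vec (Fin (suc m)) k → Fin k) →
         (ℕ → Fin (suc m) → ℚ) → ℕ → Dist ℕ
runExp r tb v zero    = return 0
runExp r tb v (suc t) =
  runExp r tb v t >>= λ c →
  priceExp r tb v (suc t) c >>= λ p →
  valDist v (suc t) >>= λ ℓ →
  return (c ℕ.+ b2n (sale r p ℓ))

jointExp : {m k : ℕ} → (Fin m → ℚ) → (Vec (Fin (suc m)) k → Fin k) →
           (ℕ → Fin (suc m) → ℚ) → ℕ → Dist (ℕ × Price m)
jointExp r tb v t = runExp r tb v (t ℕ.∸ 1) >>= λ c → priceExp r tb v t c >>= λ p → return (c , p)

StrictlyIncreasingPos : {m : ℕ} → (Fin m → ℚ) → Set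
StrictlyIncreasingPos {m} r = (∀ (i : Fin m) → 0ℚ < r i) × (∀ (i j : Fin m) → toℕ i ℕ.< toℕ j → r i < r j)

IsDistribution : {m : ℕ} → (Fin (suc m) → ℚ) → Set
IsDistribution {m} w = (∀ ℓ → 0ℚ ≤ w ℓ) × (sumℚ (map w (allFin (suc m))) ≡ 1ℚ)

IsTieBreak : {m k : ℕ} → (Vec (Fin (suc m)) k → Fin k) → Set
IsTieBreak {m} {k} tb = ∀ (lv : Vec (Fin (suc m)) k) (i : Fin k) → toℕ (lookup lv (tb lv)) ℕ.≤ toℕ (lookup lv i)

{-# OPTIONS --safe #-}

-- By induction on t: if Exp's sale count has the same law as VT's after t customers, then so
-- does the pair (count, next posted price), and hence so does the next count, the valuation
-- being drawn from the same v_{t+1} and the sale depending only on price and valuation.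
-- For the pair, slice by the count c: Exp posts from the conditional law of VT's price given
-- count c, and Pr[count = c] times that law is VT's joint weight of (c, price) because VT's
-- price law at each state has mass one (all q^(j) > 0); null slices vanish because all
-- weights are nonnegative. VT's sold flags show that it never sells more than k units, so the
-- count is determined by the inventory k ∸ count on which Exp conditions.
module Submission where

open import Algebra using (CommutativeMonoid)
import Algebra.Properties.CommutativeSemigroup as CommSemigroupProperties
open import Data.Bool using (Bool; true; false; _∧_)
open import Data.Fin as Fin using (Fin; inject₁)
import Data.Fin.Properties as Finₚ
open import Data.List using (List; []; _∷_; map; _++_; allFin; downFrom)
open import Data.List.Membership.Propositional using (_∈_)
open import Data.List.Membership.Propositional.Properties using (∈-map⁺; ∈-allFin; ∈-downFrom⁺; ∈-downFrom⁻)
open import Data.List.Relation.Unary.All as All using (All; []; _∷_)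
import Data.List.Relation.Unary.All.Properties as Allₚ
open import Data.List.Relation.Unary.AllPairs using (_∷_)
open import Data.List.Relation.Unary.Any using (here; there)
open import Data.List.Relation.Unary.Unique.Propositional using (Unique)
import Data.List.Relation.Unary.Unique.Propositional.Properties as Uniqueₚ
open import Data.Maybe using (just; nothing)
import Data.Maybe.Properties as Maybeₚ
open import Data.Nat as ℕ using (ℕ; zero; suc; _∸_; _≤_)
import Data.Nat.Properties as ℕₚ
open import Data.Product using (_×_; _,_; proj₁; proj₂)
open import Data.Rational as ℚ using (ℚ; 0ℚ; 1ℚ; _+_; _*_; _-_; -_; _<_; 1/_; ≢-nonZero; positive; nonNegative)
open import Data.Rational.Properties
open import Data.Sum using (_⊎_; inj₁; inj₂)
open import Data.Vec using (Vec; []; _∷_; replicate; lookup; _[_]≔_; countᵇ)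
open import Data.Vec.Properties using (count≤n)
open import Function using (_∘_; id)
open import Relation.Binary.Definitions using (DecidableEquality)
open import Relation.Binary.PropositionalEquality
open import Relation.Nullary using (yes; no; contradiction)
open import Relation.Nullary.Decidable using (⌊_⌋; T?; ⌊⌋-map′)

open import Defs

open CommSemigroupProperties (CommutativeMonoid.commutativeSemigroup +-0-commutativeMonoid)
  using (interchange)
open CommSemigroupProperties (CommutativeMonoid.commutativeSemigroup *-1-commutativeMonoid)
  using (x∙yz≈y∙xz)

private variable
  A B C : Set

-- Rational arithmetic

cdiv-≢0 : ∀ a {b} (b≢0 : b ≢ 0ℚ) → cdiv a b ≡ a * (1/ b) {{≢-nonZero b≢0}}
cdiv-≢0 a {b} b≢0 with b ℚ.≟ 0ℚ
... | yes b≡0 = contradiction b≡0 b≢0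
... | no  _   = refl

*-cdiv : ∀ a {b} → b ≢ 0ℚ → b * cdiv a b ≡ a
*-cdiv a {b} b≢0 = begin
  b * cdiv a b    ≡⟨ cong (b *_) (cdiv-≢0 a b≢0) ⟩
  b * (a * 1/ b)  ≡⟨ x∙yz≈y∙xz b a (1/ b) ⟩
  a * (b * 1/ b)  ≡⟨ cong (a *_) (*-inverseʳ b) ⟩
  a * 1ℚ          ≡⟨ *-identityʳ a ⟩
  a               ∎
  where
  open ≡-Reasoning
  instance
    b≠0 : ℚ.NonZero b
    b≠0 = ≢-nonZero b≢0

*-nonneg : ∀ {x y} → 0ℚ ℚ.≤ x → 0ℚ ℚ.≤ y → 0ℚ ℚ.≤ x * y
*-nonneg {x} {y} 0≤x 0≤y = subst (ℚ._≤ x * y) (*-zeroˡ y) (*-monoʳ-≤-nonNeg y {{nonNegative 0≤y}} 0≤x)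

cdiv-nonneg : ∀ {a b} → 0ℚ ℚ.≤ a → 0ℚ < b → 0ℚ ℚ.≤ cdiv a b
cdiv-nonneg {a} {b} 0≤a 0<b = subst (0ℚ ℚ.≤_) (sym (cdiv-≢0 a (≢-sym (<⇒≢ 0<b))))
  (*-nonneg 0≤a (<⇒≤ (positive⁻¹ _ {{1/pos⇒pos b {{positive 0<b}}}})))

cdiv-<1 : ∀ {a b} → 0ℚ < b → a < b → cdiv a b < 1ℚ
cdiv-<1 {a} {b} 0<b a<b = subst₂ _<_ (sym (cdiv-≢0 a b≢0)) (*-inverseʳ b {{b≠0}})
  (*-monoˡ-<-pos ((1/ b) {{b≠0}}) {{1/pos⇒pos b {{positive 0<b}}}} a<b)
  where
  b≢0 : b ≢ 0ℚ
  b≢0 = ≢-sym (<⇒≢ 0<b)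
  b≠0 : ℚ.NonZero b
  b≠0 = ≢-nonZero b≢0

x<1⇒0<1-x : ∀ {x} → x < 1ℚ → 0ℚ < 1ℚ - x
x<1⇒0<1-x {x} x<1 = subst (_< 1ℚ - x) (+-inverseʳ x) (+-monoˡ-< (- x) x<1)

nonneg-+-≡0 : ∀ {x y} → 0ℚ ℚ.≤ x → 0ℚ ℚ.≤ y → x + y ≡ 0ℚ → x ≡ 0ℚ × y ≡ 0ℚ
nonneg-+-≡0 {x} {y} 0≤x 0≤y x+y≡0 =
  ≤-antisym (subst₂ ℚ._≤_ (+-identityʳ x) x+y≡0 (+-monoʳ-≤ x 0≤y)) 0≤x ,
  ≤-antisym (subst₂ ℚ._≤_ (+-identityˡ y) x+y≡0 (+-monoˡ-≤ y 0≤x)) 0≤y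

0≤1 : 0ℚ ℚ.≤ 1ℚ
0≤1 = <⇒≤ (positive⁻¹ 1ℚ)

-- Finite sums and expectations

∑ : List A → (A → ℚ) → ℚ
∑ []      f = 0ℚ
∑ (x ∷ l) f = f x + ∑ l f

∑-cong-All : ∀ {l : List A} {f g : A → ℚ} → All (λ x → f x ≡ g x) l → ∑ l f ≡ ∑ l g
∑-cong-All []       = refl
∑-cong-All (e ∷ es) = cong₂ _+_ e (∑-cong-All es)

∑-cong : ∀ (l : List A) {f g : A → ℚ} → (∀ x → f x ≡ g x) → ∑ l f ≡ ∑ l g
∑-cong l f≗g = ∑-cong-All (All.universal f≗g l)

∑-nonneg : ∀ (l : List A) {f : A → ℚ} → (∀ x → 0ℚ ℚ.≤ f x) → 0ℚ ℚ.≤ ∑ l f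
∑-nonneg []      f≥0 = ≤-refl
∑-nonneg (x ∷ l) {f} f≥0 =
  subst (ℚ._≤ f x + ∑ l f) (+-identityʳ 0ℚ) (+-mono-≤ (f≥0 x) (∑-nonneg l f≥0))

∑-+ : ∀ (l : List A) (f g : A → ℚ) → ∑ l (λ x → f x + g x) ≡ ∑ l f + ∑ l g
∑-+ []      f g = sym (+-identityʳ 0ℚ)
∑-+ (x ∷ l) f g = trans (cong (f x + g x +_) (∑-+ l f g)) (interchange (f x) (g x) (∑ l f) (∑ l g))

∑-*ˡ : ∀ c (l : List A) (f : A → ℚ) → ∑ l (λ x → c * f x) ≡ c * ∑ l f
∑-*ˡ c []      f = sym (*-zeroʳ c)
∑-*ˡ c (x ∷ l) f = trans (cong (c * f x +_) (∑-*ˡ c l f)) (sym (*-distribˡ-+ c (f x) (∑ l f)))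

∑-*ʳ : ∀ c (l : List A) (f : A → ℚ) → ∑ l (λ x → f x * c) ≡ ∑ l f * c
∑-*ʳ c l f = trans (∑-cong l (λ x → *-comm (f x) c)) (trans (∑-*ˡ c l f) (*-comm c (∑ l f)))

∑-zero : ∀ (l : List A) → ∑ l (λ _ → 0ℚ) ≡ 0ℚ
∑-zero []      = refl
∑-zero (x ∷ l) = trans (+-identityˡ _) (∑-zero l)

∑-++ : ∀ (l₁ l₂ : List A) (f : A → ℚ) → ∑ (l₁ ++ l₂) f ≡ ∑ l₁ f + ∑ l₂ f
∑-++ []       l₂ f = sym (+-identityˡ _)
∑-++ (x ∷ l₁) l₂ f = trans (cong (f x +_) (∑-++ l₁ l₂ f)) (sym (+-assoc (f x) _ _))

∑-map : ∀ (h : B → A) (l : List B) (f : A → ℚ) → ∑ (map h l) f ≡ ∑ l (f ∘ h)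
∑-map h []      f = refl
∑-map h (x ∷ l) f = cong (f (h x) +_) (∑-map h l f)

∑-comm : ∀ (l : List A) (l′ : List B) (f : A → B → ℚ) →
         ∑ l (λ a → ∑ l′ (f a)) ≡ ∑ l′ (λ b → ∑ l (λ a → f a b))
∑-comm []      l′ f = sym (∑-zero l′)
∑-comm (x ∷ l) l′ f = trans (cong (∑ l′ (f x) +_) (∑-comm l l′ f))
                            (sym (∑-+ l′ (f x) (λ b → ∑ l (λ a → f a b))))

sumℚ-map : ∀ (f : A → ℚ) (l : List A) → sumℚ (map f l) ≡ ∑ l f
sumℚ-map f []      = refl
sumℚ-map f (x ∷ l) = cong (f x +_) (sumℚ-map f l)

𝟙 : Bool → ℚ
𝟙 true  = 1ℚ
𝟙 false = 0ℚ

𝟙-nonneg : ∀ b → 0ℚ ℚ.≤ 𝟙 b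
𝟙-nonneg true  = 0≤1
𝟙-nonneg false = ≤-refl

𝟙-∧ : ∀ a b → 𝟙 (a ∧ b) ≡ 𝟙 a * 𝟙 b
𝟙-∧ true  b = sym (*-identityˡ (𝟙 b))
𝟙-∧ false b = sym (*-zeroˡ (𝟙 b))

module _ (_≟_ : DecidableEquality A) where

  𝟙-≟-refl : ∀ x → 𝟙 ⌊ x ≟ x ⌋ ≡ 1ℚ
  𝟙-≟-refl x with x ≟ x
  ... | yes _   = refl
  ... | no  x≢x = contradiction refl x≢x

  𝟙-≟-≢ : ∀ {x y} → x ≢ y → 𝟙 ⌊ x ≟ y ⌋ ≡ 0ℚ
  𝟙-≟-≢ {x} {y} x≢y with x ≟ y
  ... | yes x≡y = contradiction x≡y x≢y
  ... | no  _   = refl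

  𝟙-≟-subst : ∀ x y (f : A → ℚ) → 𝟙 ⌊ x ≟ y ⌋ * f x ≡ 𝟙 ⌊ x ≟ y ⌋ * f y
  𝟙-≟-subst x y f with x ≟ y
  ... | yes refl = refl
  ... | no  _    = trans (*-zeroˡ (f x)) (sym (*-zeroˡ (f y)))

  ∑-select-∉ : ∀ {x} {l : List A} → All (x ≢_) l → (f : A → ℚ) →
               ∑ l (λ a → 𝟙 ⌊ x ≟ a ⌋ * f a) ≡ 0ℚ
  ∑-select-∉ []                    f = refl
  ∑-select-∉ {l = y ∷ _} (x≢y ∷ x∉) f = begin
    𝟙 ⌊ _ ≟ y ⌋ * f y + _
      ≡⟨ cong₂ _+_ (trans (cong (_* f y) (𝟙-≟-≢ x≢y)) (*-zeroˡ (f y))) (∑-select-∉ x∉ f) ⟩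
    0ℚ + 0ℚ
      ≡⟨ +-identityʳ 0ℚ ⟩
    0ℚ ∎
    where open ≡-Reasoning

  ∑-select : ∀ {x} {l : List A} → Unique l → x ∈ l → (f : A → ℚ) →
             ∑ l (λ a → 𝟙 ⌊ x ≟ a ⌋ * f a) ≡ f x
  ∑-select {x} (x∉ ∷ _) (here refl) f = begin
    𝟙 ⌊ x ≟ x ⌋ * f x + _
      ≡⟨ cong₂ _+_ (trans (cong (_* f x) (𝟙-≟-refl x)) (*-identityˡ (f x))) (∑-select-∉ x∉ f) ⟩
    f x + 0ℚ
      ≡⟨ +-identityʳ (f x) ⟩
    f x ∎
    where open ≡-Reasoning
  ∑-select {x} {y ∷ _} (y∉ ∷ u) (there x∈) f = begin
    𝟙 ⌊ x ≟ y ⌋ * f y + _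
      ≡⟨ cong₂ _+_ (trans (cong (_* f y) (𝟙-≟-≢ x≢y)) (*-zeroˡ (f y))) (∑-select u x∈ f) ⟩
    0ℚ + f x
      ≡⟨ +-identityˡ (f x) ⟩
    f x ∎
    where
    open ≡-Reasoning
    x≢y : x ≢ y
    x≢y x≡y = All.lookup y∉ x∈ (sym x≡y)

𝔼 : Dist A → (A → ℚ) → ℚ
𝔼 d g = ∑ d (λ aw → proj₂ aw * g (proj₁ aw))

Supp : (A → Set) → Dist A → Set
Supp P = All (P ∘ proj₁)

NonNeg : Dist A → Set
NonNeg = All (λ aw → 0ℚ ℚ.≤ proj₂ aw)

𝔼-cong-Supp : ∀ {d : Dist A} {g h : A → ℚ} → Supp (λ a → g a ≡ h a) d → 𝔼 d g ≡ 𝔼 d h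
𝔼-cong-Supp es = ∑-cong-All (All.map (λ {aw} → cong (proj₂ aw *_)) es)

𝔼-cong : ∀ (d : Dist A) {g h : A → ℚ} → (∀ a → g a ≡ h a) → 𝔼 d g ≡ 𝔼 d h
𝔼-cong d g≗h = 𝔼-cong-Supp (All.universal (g≗h ∘ proj₁) d)

𝔼-*ˡ : ∀ (d : Dist A) c (g : A → ℚ) → 𝔼 d (λ a → c * g a) ≡ c * 𝔼 d g
𝔼-*ˡ d c g = trans (∑-cong d (λ aw → x∙yz≈y∙xz (proj₂ aw) c (g (proj₁ aw)))) (∑-*ˡ c d _)

𝔼-*ʳ : ∀ (d : Dist A) c (g : A → ℚ) → 𝔼 d (λ a → g a * c) ≡ 𝔼 d g * c
𝔼-*ʳ d c g = trans (𝔼-cong d (λ a → *-comm (g a) c)) (trans (𝔼-*ˡ d c g) (*-comm c (𝔼 d g)))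

𝔼-const : ∀ {d : Dist A} → 𝔼 d (λ _ → 1ℚ) ≡ 1ℚ → ∀ x → 𝔼 d (λ _ → x) ≡ x
𝔼-const {d = d} mass x = begin
  𝔼 d (λ _ → x)          ≡⟨ 𝔼-cong d (λ _ → *-identityˡ x) ⟨
  𝔼 d (λ _ → 1ℚ * x)     ≡⟨ 𝔼-*ʳ d x (λ _ → 1ℚ) ⟩
  𝔼 d (λ _ → 1ℚ) * x     ≡⟨ cong (_* x) mass ⟩
  1ℚ * x                 ≡⟨ *-identityˡ x ⟩
  x                      ∎
  where open ≡-Reasoning

𝔼-∑ : ∀ (d : Dist A) (l : List B) (f : A → B → ℚ) →
      𝔼 d (λ a → ∑ l (f a)) ≡ ∑ l (λ b → 𝔼 d (λ a → f a b))
𝔼-∑ d l f = trans (∑-cong d (λ aw → sym (∑-*ˡ (proj₂ aw) l (f (proj₁ aw))))) (∑-comm d l _)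

𝔼-nonneg : ∀ {d : Dist A} {g : A → ℚ} → NonNeg d → (∀ a → 0ℚ ℚ.≤ g a) → 0ℚ ℚ.≤ 𝔼 d g
𝔼-nonneg []                                 g≥0 = ≤-refl
𝔼-nonneg {d = (a , w) ∷ d} {g} (0≤w ∷ ws) g≥0 =
  subst (ℚ._≤ w * g a + 𝔼 d g) (+-identityʳ 0ℚ) (+-mono-≤ (*-nonneg 0≤w (g≥0 a)) (𝔼-nonneg ws g≥0))

𝔼-scale : ∀ w (d : Dist A) (g : A → ℚ) → 𝔼 (map (λ aw → proj₁ aw , w * proj₂ aw) d) g ≡ w * 𝔼 d g
𝔼-scale w d g = begin
  𝔼 (map (λ aw → proj₁ aw , w * proj₂ aw) d) g  ≡⟨ ∑-map _ d _ ⟩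
  ∑ d (λ aw → w * proj₂ aw * g (proj₁ aw))       ≡⟨ ∑-cong d (λ aw → *-assoc w (proj₂ aw) _) ⟩
  ∑ d (λ aw → w * (proj₂ aw * g (proj₁ aw)))     ≡⟨ ∑-*ˡ w d _ ⟩
  w * 𝔼 d g                                      ∎
  where open ≡-Reasoning

𝔼-return : ∀ (a : A) (g : A → ℚ) → 𝔼 (return a) g ≡ g a
𝔼-return a g = trans (+-identityʳ _) (*-identityˡ (g a))

𝔼->>= : ∀ (d : Dist A) (f : A → Dist B) (g : B → ℚ) → 𝔼 (d >>= f) g ≡ 𝔼 d (λ a → 𝔼 (f a) g)
𝔼->>= []            f g = refl
𝔼->>= ((a , w) ∷ d) f g = trans (∑-++ (map _ (f a)) (d >>= f) _)
                                (cong₂ _+_ (𝔼-scale w (f a) g) (𝔼->>= d f g))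

𝔼->>=-return : ∀ (d : Dist A) (f : A → B) (g : B → ℚ) →
               𝔼 (d >>= λ a → return (f a)) g ≡ 𝔼 d (g ∘ f)
𝔼->>=-return d f g = trans (𝔼->>= d (return ∘ f) g) (𝔼-cong d (λ a → 𝔼-return (f a) g))

𝔼-pair : ∀ (d : Dist A) (e : A → Dist B) (h : A × B → ℚ) →
         𝔼 (d >>= λ a → e a >>= λ b → return (a , b)) h ≡ 𝔼 d (λ a → 𝔼 (e a) (λ b → h (a , b)))
𝔼-pair d e h = trans (𝔼->>= d _ h) (𝔼-cong d (λ a → 𝔼->>=-return (e a) (a ,_) h))

𝔼-through-pair : ∀ (d : Dist A) (e : A → Dist B) (f : A → B → Dist C) (g : C → ℚ) →
  𝔼 (d >>= λ a → e a >>= f a) g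
    ≡ 𝔼 (d >>= λ a → e a >>= λ b → return (a , b)) (λ ab → 𝔼 (f (proj₁ ab) (proj₂ ab)) g)
𝔼-through-pair d e f g = begin
  𝔼 (d >>= λ a → e a >>= f a) g                         ≡⟨ 𝔼->>= d _ g ⟩
  𝔼 d (λ a → 𝔼 (e a >>= f a) g)                         ≡⟨ 𝔼-cong d (λ a → 𝔼->>= (e a) (f a) g) ⟩
  𝔼 d (λ a → 𝔼 (e a) (λ b → 𝔼 (f a b) g))               ≡⟨ 𝔼-pair d e _ ⟨
  𝔼 (d >>= λ a → e a >>= λ b → return (a , b)) _        ∎
  where open ≡-Reasoning

Pr≡𝔼𝟙 : ∀ (d : Dist A) (E : A → Bool) → Pr d E ≡ 𝔼 d (𝟙 ∘ E)
Pr≡𝔼𝟙 []            E = refl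
Pr≡𝔼𝟙 ((a , w) ∷ d) E with E a
... | true  = cong₂ _+_ (sym (*-identityʳ w)) (Pr≡𝔼𝟙 d E)
... | false = trans (Pr≡𝔼𝟙 d E) (sym (trans (cong (_+ _) (*-zeroʳ w)) (+-identityˡ _)))

return-nonneg : ∀ (a : A) → NonNeg (return a)
return-nonneg a = 0≤1 ∷ []

>>=-nonneg : ∀ {d : Dist A} {f : A → Dist B} → NonNeg d → (∀ a → NonNeg (f a)) → NonNeg (d >>= f)
>>=-nonneg []                                 f≥0 = []
>>=-nonneg {d = (a , w) ∷ _} (0≤w ∷ ws) f≥0 =
  Allₚ.++⁺ (Allₚ.map⁺ (All.map (*-nonneg 0≤w) (f≥0 a))) (>>=-nonneg ws f≥0)

>>=-Supp : ∀ {P : A → Set} {Q : B → Set} {d : Dist A} {f : A → Dist B} →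
           Supp P d → (∀ a → P a → Supp Q (f a)) → Supp Q (d >>= f)
>>=-Supp []                           f-ok = []
>>=-Supp {d = (a , _) ∷ _} (pa ∷ ps) f-ok = Allₚ.++⁺ (Allₚ.map⁺ (f-ok a pa)) (>>=-Supp ps f-ok)

>>=-return-Supp : ∀ {Q : B → Set} (d : Dist A) (f : A → B) → (∀ a → Q (f a)) →
                  Supp Q (d >>= λ a → return (f a))
>>=-return-Supp []            f Qf = []
>>=-return-Supp ((a , _) ∷ d) f Qf = Qf a ∷ >>=-return-Supp d f Qf

𝔼-𝟙-null : ∀ {d : Dist A} (E : A → Bool) → NonNeg d → 𝔼 d (𝟙 ∘ E) ≡ 0ℚ →
           (K : A → ℚ) → 𝔼 d (λ a → 𝟙 (E a) * K a) ≡ 0ℚ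
𝔼-𝟙-null E []                                    null K = refl
𝔼-𝟙-null {d = (a , w) ∷ d} E (0≤w ∷ ws) null K = begin
  w * (𝟙 (E a) * K a) + 𝔼 d (λ a → 𝟙 (E a) * K a)
    ≡⟨ cong₂ _+_ (trans (sym (*-assoc w _ _)) (trans (cong (_* K a) (proj₁ parts)) (*-zeroˡ (K a))))
                 (𝔼-𝟙-null E ws (proj₂ parts) K) ⟩
  0ℚ + 0ℚ
    ≡⟨ +-identityʳ 0ℚ ⟩
  0ℚ ∎
  where
  open ≡-Reasoning
  parts : w * 𝟙 (E a) ≡ 0ℚ × 𝔼 d (𝟙 ∘ E) ≡ 0ℚ
  parts = nonneg-+-≡0 (*-nonneg 0≤w (𝟙-nonneg (E a))) (𝔼-nonneg ws (𝟙-nonneg ∘ E)) null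

𝔼-partition : ∀ {d : Dist A} {n} (f : A → ℕ) → Supp (λ a → f a ≤ n) d → (Φ : A → ℚ) →
              𝔼 d Φ ≡ ∑ (downFrom (suc n)) (λ c → 𝔼 d (λ a → 𝟙 ⌊ f a ℕ.≟ c ⌋ * Φ a))
𝔼-partition {d = d} {n} f f≤n Φ =
  trans (𝔼-cong-Supp (All.map split f≤n)) (𝔼-∑ d (downFrom (suc n)) (λ a c → 𝟙 ⌊ f a ℕ.≟ c ⌋ * Φ a))
  where
  split : ∀ {a} → f a ≤ n → Φ a ≡ ∑ (downFrom (suc n)) (λ c → 𝟙 ⌊ f a ℕ.≟ c ⌋ * Φ a)
  split {a} fa≤n =
    sym (∑-select ℕ._≟_ (Uniqueₚ.downFrom⁺ (suc n)) (∈-downFrom⁺ (ℕ.s≤s fa≤n)) (λ _ → Φ a))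

-- Conditional price laws

prices : ∀ {m} → List (Price m)
prices {m} = nothing ∷ map just (allFin m)

_≟ₚ_ : ∀ {m} → DecidableEquality (Price m)
_≟ₚ_ = Maybeₚ.≡-dec Finₚ._≟_

≟P≡⌊≟ₚ⌋ : ∀ {m} (p p′ : Price m) → (p ≟P p′) ≡ ⌊ p ≟ₚ p′ ⌋
≟P≡⌊≟ₚ⌋ nothing  nothing  = refl
≟P≡⌊≟ₚ⌋ nothing  (just _) = refl
≟P≡⌊≟ₚ⌋ (just _) nothing  = refl
≟P≡⌊≟ₚ⌋ (just i) (just j) = sym (⌊⌋-map′ (cong just) Maybeₚ.just-injective (i Finₚ.≟ j))

prices-unique : ∀ {m} → Unique (prices {m})
prices-unique {m} = Allₚ.map⁺ (All.universal (λ _ ()) (allFin m))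
                  ∷ Uniqueₚ.map⁺ Maybeₚ.just-injective (Uniqueₚ.allFin⁺ m)

∈-prices : ∀ {m} (p : Price m) → p ∈ prices
∈-prices nothing  = here refl
∈-prices (just i) = there (∈-map⁺ just (∈-allFin i))

∑-select-price : ∀ {m} (p : Price m) (f : Price m → ℚ) →
                 ∑ prices (λ p′ → 𝟙 (p ≟P p′) * f p′) ≡ f p
∑-select-price p f = trans (∑-cong prices (λ p′ → cong (λ b → 𝟙 b * f p′) (≟P≡⌊≟ₚ⌋ p p′)))
                           (∑-select _≟ₚ_ prices-unique (∈-prices p) f)

priceGiven : ∀ {m} → Dist (A × Price m) → (A × Price m → Bool) → Dist (Price m)
priceGiven d F = map (λ p → p , CondPr d (λ x → proj₂ x ≟P p) F) prices

𝔼-priceGiven : ∀ {m} (d : Dist (A × Price m)) (F : A × Price m → Bool) → Pr d F ≢ 0ℚ →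
               (g : Price m → ℚ) → Pr d F * 𝔼 (priceGiven d F) g ≡ 𝔼 d (λ x → 𝟙 (F x) * g (proj₂ x))
𝔼-priceGiven {m = m} d F PrF≢0 g = begin
  Pr d F * 𝔼 (priceGiven d F) g
    ≡⟨ cong (Pr d F *_) (∑-map (λ p → p , CondPr d (at p) F) prices (λ pw → proj₂ pw * g (proj₁ pw))) ⟩
  Pr d F * ∑ prices (λ p → CondPr d (at p) F * g p)
    ≡⟨ ∑-*ˡ (Pr d F) prices (λ p → CondPr d (at p) F * g p) ⟨
  ∑ prices (λ p → Pr d F * (CondPr d (at p) F * g p))
    ≡⟨ ∑-cong prices (λ p → trans (sym (*-assoc (Pr d F) _ (g p)))
                                  (cong (_* g p) (*-cdiv (Pr d (λ x → at p x ∧ F x)) PrF≢0))) ⟩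
  ∑ prices (λ p → Pr d (λ x → at p x ∧ F x) * g p)
    ≡⟨ ∑-cong prices (λ p →
         cong (_* g p) (trans (Pr≡𝔼𝟙 d _) (𝔼-cong d (λ x → 𝟙-∧ (at p x) (F x))))) ⟩
  ∑ prices (λ p → 𝔼 d (λ x → 𝟙 (at p x) * 𝟙 (F x)) * g p)
    ≡⟨ ∑-cong prices (λ p → 𝔼-*ʳ d (g p) (λ x → 𝟙 (at p x) * 𝟙 (F x))) ⟨
  ∑ prices (λ p → 𝔼 d (λ x → 𝟙 (at p x) * 𝟙 (F x) * g p))
    ≡⟨ 𝔼-∑ d prices (λ x p → 𝟙 (at p x) * 𝟙 (F x) * g p) ⟨
  𝔼 d (λ x → ∑ prices (λ p → 𝟙 (at p x) * 𝟙 (F x) * g p))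
    ≡⟨ 𝔼-cong d (λ x → trans (∑-cong prices (λ p → *-assoc (𝟙 (at p x)) (𝟙 (F x)) (g p)))
                             (∑-select-price (proj₂ x) (λ p → 𝟙 (F x) * g p))) ⟩
  𝔼 d (λ x → 𝟙 (F x) * g (proj₂ x))
    ∎
  where
  open ≡-Reasoning
  at : Price m → A × Price m → Bool
  at p x = proj₂ x ≟P p

-- VT's price law and sale accounting

module _ {m : ℕ} {r : Fin m → ℚ} (r-inc : StrictlyIncreasingPos r) where

  val-inject₁-< : ∀ i → val r (inject₁ i) < r i
  val-inject₁-< Fin.zero    = proj₁ r-inc Fin.zero
  val-inject₁-< (Fin.suc i) =
    proj₂ r-inc (inject₁ i) (Fin.suc i) (ℕ.s≤s (ℕₚ.≤-reflexive (Finₚ.toℕ-inject₁ i)))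

  q-pos : ∀ i → 0ℚ < q r i
  q-pos i = x<1⇒0<1-x (cdiv-<1 (proj₁ r-inc i) (val-inject₁-< i))

  sumℚ-q-pos : ∀ i is → 0ℚ < sumℚ (map (q r) (i ∷ is))
  sumℚ-q-pos i is = subst (_< q r i + sumℚ (map (q r) is)) (+-identityʳ 0ℚ)
    (+-mono-<-≤ (q-pos i) (subst (0ℚ ℚ.≤_) (sym (sumℚ-map (q r) is)) (∑-nonneg is (<⇒≤ ∘ q-pos))))

  vtPrice-nonneg : ∀ ℓ → NonNeg (vtPrice r ℓ)
  vtPrice-nonneg ℓ with above ℓ
  ... | []     = return-nonneg nothing
  ... | i ∷ is = Allₚ.map⁺ (All.universal (λ j → cdiv-nonneg (<⇒≤ (q-pos j)) (sumℚ-q-pos i is)) (i ∷ is))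

  vtPrice-mass : ∀ ℓ → 𝔼 (vtPrice r ℓ) (λ _ → 1ℚ) ≡ 1ℚ
  vtPrice-mass ℓ with above ℓ
  ... | []     = 𝔼-return (nothing {A = Fin m}) (λ _ → 1ℚ)
  ... | i ∷ is = begin
    𝔼 (map (λ j → just j , cdiv (q r j) S) (i ∷ is)) (λ _ → 1ℚ)
      ≡⟨ ∑-map (λ j → just j , cdiv (q r j) S) (i ∷ is) (λ aw → proj₂ aw * 1ℚ) ⟩
    ∑ (i ∷ is) (λ j → cdiv (q r j) S * 1ℚ)
      ≡⟨ ∑-cong (i ∷ is) (λ j → trans (*-identityʳ _) (cdiv-≢0 (q r j) S≢0)) ⟩
    ∑ (i ∷ is) (λ j → q r j * 1/ S)
      ≡⟨ ∑-*ʳ (1/ S) (i ∷ is) (q r) ⟩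
    ∑ (i ∷ is) (q r) * 1/ S
      ≡⟨ cong (_* 1/ S) (sumℚ-map (q r) (i ∷ is)) ⟨
    S * 1/ S
      ≡⟨ *-inverseʳ S ⟩
    1ℚ ∎
    where
    open ≡-Reasoning
    S : ℚ
    S = sumℚ (map (q r) (i ∷ is))
    S≢0 : S ≢ 0ℚ
    S≢0 = ≢-sym (<⇒≢ (sumℚ-q-pos i is))
    instance
      S≠0 : ℚ.NonZero S
      S≠0 = ≢-nonZero S≢0

  module _ {k : ℕ} (tb : Vec (Fin (suc m)) k → Fin k) where

    priceA1-nonneg : ∀ s → NonNeg (priceA1 r tb s)
    priceA1-nonneg s with lookup (sold s) (tb (level s))
    ... | true  = return-nonneg nothing
    ... | false = vtPrice-nonneg _

    𝔼-priceA1-const : ∀ s x → 𝔼 (priceA1 r tb s) (λ _ → x) ≡ x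
    𝔼-priceA1-const s = 𝔼-const {d = priceA1 r tb s} mass
      where
      mass : 𝔼 (priceA1 r tb s) (λ _ → 1ℚ) ≡ 1ℚ
      mass with lookup (sold s) (tb (level s))
      ... | true  = 𝔼-return (nothing {A = Fin m}) (λ _ → 1ℚ)
      ... | false = vtPrice-mass _

countᵇ-replicate-false : ∀ n → countᵇ id (replicate n false) ≡ 0
countᵇ-replicate-false zero    = refl
countᵇ-replicate-false (suc n) = countᵇ-replicate-false n

countᵇ-[]≔true : ∀ {n} (bs : Vec Bool n) i → lookup bs i ≡ false →
                 countᵇ id (bs [ i ]≔ true) ≡ suc (countᵇ id bs)
countᵇ-[]≔true (false ∷ bs) Fin.zero    _        = refl
countᵇ-[]≔true (true  ∷ bs) (Fin.suc i) bs[i]≡f = cong suc (countᵇ-[]≔true bs i bs[i]≡f)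
countᵇ-[]≔true (false ∷ bs) (Fin.suc i) bs[i]≡f = countᵇ-[]≔true bs i bs[i]≡f

module _ {m k : ℕ} (r : Fin m → ℚ) (tb : Vec (Fin (suc m)) k → Fin k) where

  Balanced : StateA1 m k → Set
  Balanced s = countᵇ id (sold s) ≡ cnt s

  PostableAt : StateA1 m k → Price m → Set
  PostableAt s p = lookup (sold s) (tb (level s)) ≡ false ⊎ p ≡ nothing

  priceA1-postable : ∀ s → Supp (PostableAt s) (priceA1 r tb s)
  priceA1-postable s with lookup (sold s) (tb (level s))
  ... | true  = inj₂ refl ∷ []
  ... | false = All.universal (λ _ → inj₁ refl) _

  updateA1-balanced : ∀ s p ℓ → Balanced s → PostableAt s p → Balanced (updateA1 r tb s p ℓ)
  updateA1-balanced s nothing  ℓ bal _ = trans bal (sym (ℕₚ.+-identityʳ (cnt s)))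
  updateA1-balanced s (just j) ℓ bal (inj₁ unsold) with sale r (just j) ℓ
  ... | false = trans bal (sym (ℕₚ.+-identityʳ (cnt s)))
  ... | true  = trans (countᵇ-[]≔true (sold s) _ unsold) (trans (cong suc bal) (ℕₚ.+-comm 1 (cnt s)))

  runA1-balanced : ∀ v t → Supp Balanced (runA1 r tb v t)
  runA1-balanced v zero    = countᵇ-replicate-false k ∷ []
  runA1-balanced v (suc t) =
    >>=-Supp (runA1-balanced v t) λ s bal →
    >>=-Supp (priceA1-postable s) λ p postable →
    >>=-return-Supp (valDist v (suc t)) (updateA1 r tb s p) λ ℓ →
    updateA1-balanced s p ℓ bal postable

  runA1-cnt≤k : ∀ v t → Supp (λ s → cnt s ≤ k) (runA1 r tb v t)
  runA1-cnt≤k v t = All.map (λ {sw} bal → subst (_≤ k) bal (count≤n (T? ∘ id) (sold (proj₁ sw))))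
                            (runA1-balanced v t)

-- Coupling Exp with VT

invIs-≟ : ∀ {k c} → c ≤ k → ∀ n → invIs k n (k ∸ c) ≡ ⌊ n ℕ.≟ c ⌋
invIs-≟ {k} {c} c≤k n with n ℕ.+ (k ∸ c) ℕ.≟ k | n ℕ.≟ c
... | yes _        | yes _    = refl
... | no  _        | no  _    = refl
... | yes sum≡k    | no  n≢c  =
  contradiction (ℕₚ.+-cancelʳ-≡ (k ∸ c) n c (trans sum≡k (sym (ℕₚ.m+[n∸m]≡n c≤k)))) n≢c
... | no  sum≢k    | yes refl = contradiction (ℕₚ.m+[n∸m]≡n c≤k) sum≢k

module Coupling {m k : ℕ} {r : Fin m → ℚ} (r-inc : StrictlyIncreasingPos r)
                (tb : Vec (Fin (suc m)) k → Fin k) (v : ℕ → Fin (suc m) → ℚ)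
                (T : ℕ) (v-nonneg : ∀ t → 1 ≤ t → t ≤ T → ∀ ℓ → 0ℚ ℚ.≤ v t ℓ) where

  runA1-nonneg : ∀ t → t ≤ T → NonNeg (runA1 r tb v t)
  runA1-nonneg zero    _   = return-nonneg initA1
  runA1-nonneg (suc t) t<T =
    >>=-nonneg (runA1-nonneg t (ℕₚ.<⇒≤ t<T)) λ s →
    >>=-nonneg (priceA1-nonneg r-inc tb s) λ p →
    >>=-nonneg {f = λ ℓ → return (updateA1 r tb s p ℓ)} valDist-nonneg λ ℓ →
    return-nonneg _
    where
    valDist-nonneg : NonNeg (valDist v (suc t))
    valDist-nonneg = Allₚ.map⁺ (All.universal (v-nonneg (suc t) (ℕ.s≤s ℕ.z≤n) t<T) (allFin (suc m)))

  [cnt≡_] : ℕ → StateA1 m k → ℚ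
  [cnt≡ c ] s = 𝟙 ⌊ cnt s ℕ.≟ c ⌋

  -- Exp sees only the inventory k ∸ c, which identifies the sale count c only when c ≤ k (invIs-≟).
  soldExactly : ℕ → StateA1 m k × Price m → Bool
  soldExactly c sp = invIs k (cnt (proj₁ sp)) (k ∸ c)

  priceExp-given : ∀ t c → Pr (jointA1 r tb v t) (soldExactly c) ≢ 0ℚ →
                   priceExp r tb v t c ≡ priceGiven (jointA1 r tb v t) (soldExactly c)
  priceExp-given t c Pr≢0 = given (soldExactly c) refl
    where
    -- With F abstract, `with` cannot also rewrite the identical test hidden inside cdiv on the right.
    given : ∀ F → soldExactly c ≡ F → priceExp r tb v t c ≡ priceGiven (jointA1 r tb v t) F
    given F F≡ with Pr (jointA1 r tb v t) (λ sp → invIs k (cnt (proj₁ sp)) (k ∸ c)) ℚ.≟ 0ℚ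
    ... | yes Pr≡0 = contradiction Pr≡0 Pr≢0
    ... | no  _    = cong (priceGiven (jointA1 r tb v t)) F≡

  𝔼-jointA1-soldExactly : ∀ t {c} → c ≤ k → (g : Price m → ℚ) →
    𝔼 (jointA1 r tb v (suc t)) (λ sp → 𝟙 (soldExactly c sp) * g (proj₂ sp))
      ≡ 𝔼 (runA1 r tb v t) (λ s → [cnt≡ c ] s * 𝔼 (priceA1 r tb s) g)
  𝔼-jointA1-soldExactly t {c} c≤k g =
    trans (𝔼-pair (runA1 r tb v t) (priceA1 r tb) (λ sp → 𝟙 (soldExactly c sp) * g (proj₂ sp)))
          (𝔼-cong (runA1 r tb v t) λ s →
            trans (𝔼-*ˡ (priceA1 r tb s) (𝟙 (invIs k (cnt s) (k ∸ c))) g)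
                  (cong (λ b → 𝟙 b * 𝔼 (priceA1 r tb s) g) (invIs-≟ c≤k (cnt s))))

  Pr-jointA1-soldExactly : ∀ t {c} → c ≤ k →
    Pr (jointA1 r tb v (suc t)) (soldExactly c) ≡ 𝔼 (runA1 r tb v t) [cnt≡ c ]
  Pr-jointA1-soldExactly t {c} c≤k = begin
    Pr (jointA1 r tb v (suc t)) (soldExactly c)
      ≡⟨ Pr≡𝔼𝟙 (jointA1 r tb v (suc t)) (soldExactly c) ⟩
    𝔼 (jointA1 r tb v (suc t)) (λ sp → 𝟙 (soldExactly c sp))
      ≡⟨ 𝔼-cong (jointA1 r tb v (suc t)) (λ sp → *-identityʳ _) ⟨
    𝔼 (jointA1 r tb v (suc t)) (λ sp → 𝟙 (soldExactly c sp) * 1ℚ)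
      ≡⟨ 𝔼-jointA1-soldExactly t c≤k (λ _ → 1ℚ) ⟩
    𝔼 (runA1 r tb v t) (λ s → [cnt≡ c ] s * 𝔼 (priceA1 r tb s) (λ _ → 1ℚ))
      ≡⟨ 𝔼-cong (runA1 r tb v t) (λ s →
           trans (cong ([cnt≡ c ] s *_) (𝔼-priceA1-const r-inc tb s 1ℚ)) (*-identityʳ _)) ⟩
    𝔼 (runA1 r tb v t) [cnt≡ c ]
      ∎
    where open ≡-Reasoning

  priceExp-law : ∀ t → t ≤ T → ∀ {c} → c ≤ k → (g : Price m → ℚ) →
    𝔼 (runA1 r tb v t) [cnt≡ c ] * 𝔼 (priceExp r tb v (suc t) c) g
      ≡ 𝔼 (runA1 r tb v t) (λ s → [cnt≡ c ] s * 𝔼 (priceA1 r tb s) g)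
  priceExp-law t t≤T {c} c≤k g with 𝔼 (runA1 r tb v t) [cnt≡ c ] ℚ.≟ 0ℚ
  ... | yes null = begin
    𝔼 (runA1 r tb v t) [cnt≡ c ] * 𝔼 (priceExp r tb v (suc t) c) g
      ≡⟨ cong (_* 𝔼 (priceExp r tb v (suc t) c) g) null ⟩
    0ℚ * 𝔼 (priceExp r tb v (suc t) c) g
      ≡⟨ *-zeroˡ (𝔼 (priceExp r tb v (suc t) c) g) ⟩
    0ℚ
      ≡⟨ 𝔼-𝟙-null (λ s → ⌊ cnt s ℕ.≟ c ⌋) (runA1-nonneg t t≤T) null (λ s → 𝔼 (priceA1 r tb s) g)
       ⟨
    𝔼 (runA1 r tb v t) (λ s → [cnt≡ c ] s * 𝔼 (priceA1 r tb s) g)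
      ∎
    where open ≡-Reasoning
  ... | no  a≢0  = begin
    𝔼 (runA1 r tb v t) [cnt≡ c ] * 𝔼 (priceExp r tb v (suc t) c) g
      ≡⟨ cong₂ _*_ (sym PrF≡a) (cong (λ d → 𝔼 d g) (priceExp-given (suc t) c PrF≢0)) ⟩
    Pr (jointA1 r tb v (suc t)) (soldExactly c) * 𝔼 (priceGiven (jointA1 r tb v (suc t)) (soldExactly c)) g
      ≡⟨ 𝔼-priceGiven (jointA1 r tb v (suc t)) (soldExactly c) PrF≢0 g ⟩
    𝔼 (jointA1 r tb v (suc t)) (λ sp → 𝟙 (soldExactly c sp) * g (proj₂ sp))
      ≡⟨ 𝔼-jointA1-soldExactly t c≤k g ⟩
    𝔼 (runA1 r tb v t) (λ s → [cnt≡ c ] s * 𝔼 (priceA1 r tb s) g)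
      ∎
    where
    open ≡-Reasoning
    PrF≡a : Pr (jointA1 r tb v (suc t)) (soldExactly c) ≡ 𝔼 (runA1 r tb v t) [cnt≡ c ]
    PrF≡a = Pr-jointA1-soldExactly t c≤k
    PrF≢0 : Pr (jointA1 r tb v (suc t)) (soldExactly c) ≢ 0ℚ
    PrF≢0 = a≢0 ∘ trans (sym PrF≡a)

  priceExp-slice : ∀ t → t ≤ T → ∀ {c} → c ≤ k → (h : ℕ → Price m → ℚ) →
    𝔼 (runA1 r tb v t) (λ s → [cnt≡ c ] s * 𝔼 (priceExp r tb v (suc t) (cnt s)) (h (cnt s)))
      ≡ 𝔼 (runA1 r tb v t) (λ s → [cnt≡ c ] s * 𝔼 (priceA1 r tb s) (h (cnt s)))
  priceExp-slice t t≤T {c} c≤k h = begin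
    𝔼 (runA1 r tb v t) (λ s → [cnt≡ c ] s * 𝔼 (priceExp r tb v (suc t) (cnt s)) (h (cnt s)))
      ≡⟨ 𝔼-cong (runA1 r tb v t) (λ s →
           𝟙-≟-subst ℕ._≟_ (cnt s) c (λ n → 𝔼 (priceExp r tb v (suc t) n) (h n))) ⟩
    𝔼 (runA1 r tb v t) (λ s → [cnt≡ c ] s * 𝔼 (priceExp r tb v (suc t) c) (h c))
      ≡⟨ 𝔼-*ʳ (runA1 r tb v t) (𝔼 (priceExp r tb v (suc t) c) (h c)) [cnt≡ c ] ⟩
    𝔼 (runA1 r tb v t) [cnt≡ c ] * 𝔼 (priceExp r tb v (suc t) c) (h c)
      ≡⟨ priceExp-law t t≤T c≤k (h c) ⟩
    𝔼 (runA1 r tb v t) (λ s → [cnt≡ c ] s * 𝔼 (priceA1 r tb s) (h c))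
      ≡⟨ 𝔼-cong (runA1 r tb v t) (λ s →
           𝟙-≟-subst ℕ._≟_ (cnt s) c (λ n → 𝔼 (priceA1 r tb s) (h n))) ⟨
    𝔼 (runA1 r tb v t) (λ s → [cnt≡ c ] s * 𝔼 (priceA1 r tb s) (h (cnt s)))
      ∎
    where open ≡-Reasoning

  joint-law-from-count-law : ∀ t → t ≤ T →
    (∀ (G : ℕ → ℚ) → 𝔼 (runExp r tb v t) G ≡ 𝔼 (runA1 r tb v t) (G ∘ cnt)) →
    (h : ℕ → Price m → ℚ) →
    𝔼 (jointExp r tb v (suc t)) (λ cp → h (proj₁ cp) (proj₂ cp))
      ≡ 𝔼 (jointA1 r tb v (suc t)) (λ sp → h (cnt (proj₁ sp)) (proj₂ sp))
  joint-law-from-count-law t t≤T count-law h = begin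
    𝔼 (jointExp r tb v (suc t)) (λ cp → h (proj₁ cp) (proj₂ cp))
      ≡⟨ 𝔼-pair (runExp r tb v t) (priceExp r tb v (suc t)) _ ⟩
    𝔼 (runExp r tb v t) (λ c → 𝔼 (priceExp r tb v (suc t) c) (h c))
      ≡⟨ count-law (λ c → 𝔼 (priceExp r tb v (suc t) c) (h c)) ⟩
    𝔼 (runA1 r tb v t) (λ s → 𝔼 (priceExp r tb v (suc t) (cnt s)) (h (cnt s)))
      ≡⟨ 𝔼-partition cnt (runA1-cnt≤k r tb v t) _ ⟩
    ∑ (downFrom (suc k)) (λ c →
        𝔼 (runA1 r tb v t) (λ s → [cnt≡ c ] s * 𝔼 (priceExp r tb v (suc t) (cnt s)) (h (cnt s))))
      ≡⟨ ∑-cong-All (All.tabulate λ c∈ → priceExp-slice t t≤T (ℕ.s≤s⁻¹ (∈-downFrom⁻ c∈)) h) ⟩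
    ∑ (downFrom (suc k)) (λ c → 𝔼 (runA1 r tb v t) (λ s → [cnt≡ c ] s * 𝔼 (priceA1 r tb s) (h (cnt s))))
      ≡⟨ 𝔼-partition cnt (runA1-cnt≤k r tb v t) _ ⟨
    𝔼 (runA1 r tb v t) (λ s → 𝔼 (priceA1 r tb s) (h (cnt s)))
      ≡⟨ 𝔼-pair (runA1 r tb v t) (priceA1 r tb) _ ⟨
    𝔼 (jointA1 r tb v (suc t)) (λ sp → h (cnt (proj₁ sp)) (proj₂ sp))
      ∎
    where open ≡-Reasoning

  count-law : ∀ t → t ≤ T → (G : ℕ → ℚ) → 𝔼 (runExp r tb v t) G ≡ 𝔼 (runA1 r tb v t) (G ∘ cnt)
  count-law zero    _   G = trans (𝔼-return 0 G) (sym (𝔼-return (initA1 {m} {k}) (G ∘ cnt)))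
  count-law (suc t) t<T G = begin
    𝔼 (runExp r tb v (suc t)) G
      ≡⟨ 𝔼-through-pair (runExp r tb v t) (priceExp r tb v (suc t)) expStep G ⟩
    𝔼 (jointExp r tb v (suc t)) (λ cp → 𝔼 (expStep (proj₁ cp) (proj₂ cp)) G)
      ≡⟨ joint-law-from-count-law t t≤T (count-law t t≤T) (λ c p → 𝔼 (expStep c p) G) ⟩
    𝔼 (jointA1 r tb v (suc t)) (λ sp → 𝔼 (expStep (cnt (proj₁ sp)) (proj₂ sp)) G)
      ≡⟨ 𝔼-cong (jointA1 r tb v (suc t)) (λ sp → same-step (proj₁ sp) (proj₂ sp)) ⟨
    𝔼 (jointA1 r tb v (suc t)) (λ sp → 𝔼 (vtStep (proj₁ sp) (proj₂ sp)) (G ∘ cnt))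
      ≡⟨ 𝔼-through-pair (runA1 r tb v t) (priceA1 r tb) vtStep (G ∘ cnt) ⟨
    𝔼 (runA1 r tb v (suc t)) (G ∘ cnt)
      ∎
    where
    open ≡-Reasoning
    t≤T : t ≤ T
    t≤T = ℕₚ.<⇒≤ t<T
    expStep : ℕ → Price m → Dist ℕ
    expStep c p = valDist v (suc t) >>= λ ℓ → return (c ℕ.+ b2n (sale r p ℓ))
    vtStep : StateA1 m k → Price m → Dist (StateA1 m k)
    vtStep s p = valDist v (suc t) >>= λ ℓ → return (updateA1 r tb s p ℓ)
    same-step : ∀ s p → 𝔼 (vtStep s p) (G ∘ cnt) ≡ 𝔼 (expStep (cnt s) p) G
    same-step s p = trans (𝔼->>=-return (valDist v (suc t)) (updateA1 r tb s p) (G ∘ cnt))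
                          (sym (𝔼->>=-return (valDist v (suc t)) (λ ℓ → cnt s ℕ.+ b2n (sale r p ℓ)) G))

  Pr-count-law : ∀ t → t ≤ T → (E : ℕ → Bool) → Pr (runExp r tb v t) E ≡ Pr (runA1 r tb v t) (E ∘ cnt)
  Pr-count-law t t≤T E = trans (Pr≡𝔼𝟙 (runExp r tb v t) E)
    (trans (count-law t t≤T (𝟙 ∘ E)) (sym (Pr≡𝔼𝟙 (runA1 r tb v t) (E ∘ cnt))))

  Pr-joint-law : ∀ t → t ≤ T → (E : ℕ → Price m → Bool) →
    Pr (jointExp r tb v (suc t)) (λ cp → E (proj₁ cp) (proj₂ cp))
      ≡ Pr (jointA1 r tb v (suc t)) (λ sp → E (cnt (proj₁ sp)) (proj₂ sp))
  Pr-joint-law t t≤T E = trans (Pr≡𝔼𝟙 (jointExp r tb v (suc t)) _)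
    (trans (joint-law-from-count-law t t≤T (count-law t t≤T) (λ c p → 𝟙 (E c p)))
           (sym (Pr≡𝔼𝟙 (jointA1 r tb v (suc t)) _)))

lemma4 : (m k T : ℕ) → 1 ≤ m → 1 ≤ k →
    (r : Fin m → ℚ) → StrictlyIncreasingPos r →
    (v : ℕ → Fin (suc m) → ℚ) → (∀ t → 1 ≤ t → t ≤ T → IsDistribution (v t)) →
    (tb : Vec (Fin (suc m)) k → Fin k) → IsTieBreak tb →
    ((t k' : ℕ) → 1 ≤ t → t ≤ T → k' ≤ k →
       0ℚ < Pr (runExp r tb v (t ∸ 1)) (λ c → invIs k c k') →
       (p : Price m) →
       CondPr (jointExp r tb v t) (λ cp → proj₂ cp ≟P p) (λ cp → invIs k (proj₁ cp) k')
         ≡ CondPr (jointA1 r tb v t) (λ sp → proj₂ sp ≟P p) (λ sp → invIs k (cnt (proj₁ sp)) k'))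
    ×
    ((t k' : ℕ) → t ≤ T → k' ≤ k →
       Pr (runExp r tb v t) (λ c → invIs k c k') ≡ Pr (runA1 r tb v t) (λ s → invIs k (cnt s) k'))
lemma4 m k T _ _ r r-inc v v-dist tb _ =
  (λ { zero _ ()
     ; (suc t) k' _ t<T _ _ p →
         cong₂ cdiv (Pr-joint-law t (ℕₚ.<⇒≤ t<T) (λ c p′ → (p′ ≟P p) ∧ invIs k c k'))
                    (Pr-joint-law t (ℕₚ.<⇒≤ t<T) (λ c _ → invIs k c k')) }) ,
  (λ t k' t≤T _ → Pr-count-law t t≤T (λ c → invIs k c k'))
  where open Coupling r-inc tb v T (λ t 1≤t t≤T → proj₁ (v-dist t 1≤t t≤T))
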